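{- Write the Tribonacci word as $\mathbf{t}=u_0u_1u_2\cdots$ with $u_i\in\{0,1,2\}$, and let $\beta$ be the real root of $x^3-x^2-x-1$. Then for every nonnegative integer $N$, $$-0.6<|u_0u_1\cdots u_{N-1}|_0-\frac{N}{\beta}<0.9.$$
   Context: Let $\tau$ be the morphism on $\{0,1,2\}^*$ given by $0\mapsto 01$, $1\mapsto 02$, $2\mapsto 0$, and let $\mathbf{t}=\lim_{n\to\infty}\tau^n(0)$ be its fixed point. For a finite word $w$, $|w|_a$ denotes the number of occurrences of the letter $a$ in $w$. ($\beta\approx1.83928$.) -}

module Defs where

open import Data.Nat using (ℕ; zero; suc)
open import Data.Fin using (Fin; zero; suc)
open import Data.Fin.Properties using (_≟_)
open import Data.List using (List; []; _∷_; _++_; concatMap; take; filter; length)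
open import Data.Integer using (+_)
open import Data.Rational using (ℚ; _/_; _*_; _-_; _<_; 0ℚ; 1ℚ)


Letter : Set
Letter = Fin 3

τ-letter : Letter → List Letter
τ-letter zero = zero ∷ suc zero ∷ []
τ-letter (suc zero) = zero ∷ suc (suc zero) ∷ []
τ-letter (suc (suc zero)) = zero ∷ []

τ : List Letter → List Letter
τ = concatMap τ-letter

τⁿ0 : ℕ → List Letter
τⁿ0 zero = zero ∷ []
τⁿ0 (suc n) = τ (τⁿ0 n)

-- u_0 u_1 ... u_{N-1}: the length-N prefix of the fixed point t = lim τ^n(0).
-- Since τ^n(0) is a prefix of τ^(n+1)(0) and |τ^N(0)| ≥ N+1, this is
-- the length-N prefix of τ^N(0).
prefix : ℕ → List Letter
prefix N = take N (τⁿ0 N)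

count0 : List Letter → ℕ
count0 w = length (filter (_≟ zero) w)

-- β is the unique real root of p(x) = x^3 - x^2 - x - 1.
-- p has exactly one real root, so for a rational q:
--   q < β  iff  p(q) < 0,   and   β < q  iff  p(q) > 0.
p : ℚ → ℚ
p q = q * q * q - q * q - q - 1ℚ

_<β : ℚ → Set
q <β = p q < 0ℚ

β<_ : ℚ → Set
β< q = 0ℚ < p q

{-# OPTIONS --safe #-}
-- Every prefix of τ(u) is τ applied to a prefix of u, followed by at most one 0.
-- So the letter counts (N, |w|₀, |w|₁) of the prefixes of t are generated from
-- (0, 0, 0) by two explicit affine maps, and the theorem follows from an invariant
-- of these maps: six strict inequalities linear in the counts with coefficients in
-- ℤ[β].  Preservation is certified by identities in ℤ[β] exhibiting each new
-- inequality, times a positive multiple of a power of β, as a sum of powers of β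
-- times old inequalities and 1; these identities are checked by evaluation.
-- No real numbers are needed: x ∈ ℤ[β] is replaced by an integer sequence
-- behaving like x βⁿ, and x > 0 by eventual positivity of that sequence.  At the
-- end, b Tₙ < x Tₙ₊₁ for three consecutive Tribonacci numbers forces p(b/x) < 0.
module Submission where

open import Defs
open import Data.Nat using (ℕ; zero; suc)
open import Data.Product using (∃-syntax; _×_; _,_)
open import Data.List using (List; []; _∷_)
open import Relation.Binary.PropositionalEquality using (_≡_; refl; sym; trans; cong; cong₂; subst; module ≡-Reasoning)


module Eventual where

  open import Data.Nat using (_≤_; _+_; _∸_)
  open import Data.Nat.Properties
    using (≤-refl; ≤-trans; n≤1+n; m≤n⇒m≤1+n; m≤n+m; m≤m+n; m+[n∸m]≡n; m+n∸m≡n; ∸-monoˡ-≤)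

  record Eventually (P : ℕ → Set) : Set where
    constructor from_onwards_
    field
      start : ℕ
      holds : ∀ n → start ≤ n → P n

  Eventually-map : ∀ {P Q} → (∀ {n} → P n → Q n) → Eventually P → Eventually Q
  Eventually-map f (from n₀ onwards h) = from n₀ onwards λ n n₀≤n → f (h n n₀≤n)

  Eventually-zipWith : ∀ {P Q R} → (∀ {n} → P n → Q n → R n) → Eventually P → Eventually Q → Eventually R
  Eventually-zipWith f (from m₀ onwards g) (from n₀ onwards h) = from m₀ + n₀ onwards λ n le →
    f (g n (≤-trans (m≤m+n m₀ n₀) le)) (h n (≤-trans (m≤n+m n₀ m₀) le))

  Eventually-drop : ∀ {P} k → Eventually P → Eventually (λ n → P (k + n))
  Eventually-drop k (from n₀ onwards h) = from n₀ onwards λ n n₀≤n → h (k + n) (≤-trans n₀≤n (m≤n+m n k))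

  Eventually-undrop : ∀ {P} k → Eventually (λ n → P (k + n)) → Eventually P
  Eventually-undrop {P} k (from n₀ onwards h) = from k + n₀ onwards λ n k+n₀≤n →
    subst P (m+[n∸m]≡n (≤-trans (m≤m+n k n₀) k+n₀≤n))
      (h (n ∸ k) (subst (_≤ n ∸ k) (m+n∸m≡n k n₀) (∸-monoˡ-≤ k k+n₀≤n)))

  Eventually-consecutive : ∀ {P} → Eventually P → ∃[ n ] (P n × P (suc n) × P (suc (suc n)))
  Eventually-consecutive (from n₀ onwards h) =
    n₀ , h n₀ ≤-refl , h (suc n₀) (n≤1+n n₀) , h (suc (suc n₀)) (m≤n⇒m≤1+n (n≤1+n n₀))


-- ⟨ a , b , c ⟩ : ℤ[β] stands for a + bβ + cβ², and is modelled by the integer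
-- sequence n ↦ a Tₙ + b Tₙ₊₁ + c Tₙ₊₂.  Because β³ = β² + β + 1 and (Tₙ) obeys
-- the same recurrence, multiplication by β is the shift of this sequence.
module TribonacciForms where

  open Eventual
  open import Data.Nat as ℕ using (z≤n; s≤s)
  open import Data.Nat.Properties using (<-≤-trans; m≤n+m)
  open import Data.Integer using (ℤ; +_; _+_; _*_; _<_; 0ℤ; +<+)
  open import Data.Integer.Properties using (pos-+; +-mono-<; *-zeroʳ; *-cancelˡ-<-nonNeg; module ≤-Reasoning)
  open import Data.Integer.Tactic.RingSolver using (solve-∀)
  open import Data.List using (map)

  trib : ℕ → ℕ
  trib 0 = 1
  trib 1 = 1
  trib 2 = 1
  trib (suc (suc (suc n))) = trib (suc (suc n)) ℕ.+ trib (suc n) ℕ.+ trib n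

  trib-pos : ∀ n → 0 ℕ.< trib n
  trib-pos 0 = s≤s z≤n
  trib-pos 1 = s≤s z≤n
  trib-pos 2 = s≤s z≤n
  trib-pos (suc (suc (suc n))) = <-≤-trans (trib-pos n) (m≤n+m (trib n) _)

  +trib-rec : ∀ n → + trib (suc (suc (suc n))) ≡ + trib (suc (suc n)) + + trib (suc n) + + trib n
  +trib-rec n = trans (pos-+ _ (trib n)) (cong (_+ + trib n) (pos-+ (trib (suc (suc n))) _))

  EventuallyPositive : (ℕ → ℤ) → Set
  EventuallyPositive s = Eventually (λ n → 0ℤ < s n)

  record ℤ[β] : Set where
    constructor ⟨_,_,_⟩
    field
      coeff₀ coeff₁ coeff₂ : ℤ

  0ᵇ 1ᵇ : ℤ[β]
  0ᵇ = ⟨ + 0 , + 0 , + 0 ⟩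
  1ᵇ = ⟨ + 1 , + 0 , + 0 ⟩

  infixl 6 _+ᵇ_
  _+ᵇ_ : ℤ[β] → ℤ[β] → ℤ[β]
  ⟨ a , b , c ⟩ +ᵇ ⟨ d , e , f ⟩ = ⟨ a + d , b + e , c + f ⟩

  infixr 7 _·ᵇ_
  _·ᵇ_ : ℕ → ℤ[β] → ℤ[β]
  k ·ᵇ ⟨ a , b , c ⟩ = ⟨ + k * a , + k * b , + k * c ⟩

  β·ᵇ_ : ℤ[β] → ℤ[β]
  β·ᵇ ⟨ a , b , c ⟩ = ⟨ c , a + c , b + c ⟩

  ⟦_⟧ : ℤ[β] → ℕ → ℤ
  ⟦ ⟨ a , b , c ⟩ ⟧ n = a * + trib n + b * + trib (suc n) + c * + trib (suc (suc n))

  ⟦⟧-+ : ∀ x y n → ⟦ x +ᵇ y ⟧ n ≡ ⟦ x ⟧ n + ⟦ y ⟧ n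
  ⟦⟧-+ ⟨ a , b , c ⟩ ⟨ d , e , f ⟩ n = distrib a b c d e f (+ trib n) (+ trib (suc n)) (+ trib (suc (suc n)))
    where
    distrib : ∀ a b c d e f t₀ t₁ t₂ →
      (a + d) * t₀ + (b + e) * t₁ + (c + f) * t₂ ≡ (a * t₀ + b * t₁ + c * t₂) + (d * t₀ + e * t₁ + f * t₂)
    distrib = solve-∀

  ⟦⟧-· : ∀ k x n → ⟦ k ·ᵇ x ⟧ n ≡ + k * ⟦ x ⟧ n
  ⟦⟧-· k ⟨ a , b , c ⟩ n = distrib (+ k) a b c (+ trib n) (+ trib (suc n)) (+ trib (suc (suc n)))
    where
    distrib : ∀ k a b c t₀ t₁ t₂ → k * a * t₀ + k * b * t₁ + k * c * t₂ ≡ k * (a * t₀ + b * t₁ + c * t₂)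
    distrib = solve-∀

  ⟦⟧-β· : ∀ x n → ⟦ β·ᵇ x ⟧ n ≡ ⟦ x ⟧ (suc n)
  ⟦⟧-β· ⟨ a , b , c ⟩ n = begin
    c * t₀ + (a + c) * t₁ + (b + c) * t₂  ≡⟨ shift a b c t₀ t₁ t₂ ⟩
    a * t₁ + b * t₂ + c * (t₂ + t₁ + t₀)  ≡⟨ cong (λ t₃ → a * t₁ + b * t₂ + c * t₃) (+trib-rec n) ⟨
    ⟦ ⟨ a , b , c ⟩ ⟧ (suc n)              ∎
    where
    t₀ = + trib n
    t₁ = + trib (suc n)
    t₂ = + trib (suc (suc n))
    shift : ∀ a b c t₀ t₁ t₂ →
      c * t₀ + (a + c) * t₁ + (b + c) * t₂ ≡ a * t₁ + b * t₂ + c * (t₂ + t₁ + t₀)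
    shift = solve-∀
    open ≡-Reasoning

  ⟦1ᵇ⟧ : ∀ n → ⟦ 1ᵇ ⟧ n ≡ + trib n
  ⟦1ᵇ⟧ n = unit (+ trib n) (+ trib (suc n)) (+ trib (suc (suc n)))
    where
    unit : ∀ t₀ t₁ t₂ → + 1 * t₀ + + 0 * t₁ + + 0 * t₂ ≡ t₀
    unit = solve-∀

  record Counts : Set where
    constructor counts
    field
      size zeros ones : ℕ

  empty : Counts
  empty = counts 0 0 0

  -- the counts of τ(w) 0^ε, from those of w
  τ-counts : ℕ → Counts → Counts
  τ-counts ε (counts N a b) = counts (N ℕ.+ a ℕ.+ b ℕ.+ ε) (N ℕ.+ ε) a

  linear : Counts → ℤ → ℤ → ℤ → ℤ → ℤ
  linear (counts N a b) S Z O C = + N * S + + a * Z + + b * O + C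

  linear-cong : ∀ w {S S′ Z Z′ O O′ C C′} → S ≡ S′ → Z ≡ Z′ → O ≡ O′ → C ≡ C′ →
    linear w S Z O C ≡ linear w S′ Z′ O′ C′
  linear-cong w refl refl refl refl = refl

  linear-+ : ∀ w S Z O C S′ Z′ O′ C′ →
    linear w (S + S′) (Z + Z′) (O + O′) (C + C′) ≡ linear w S Z O C + linear w S′ Z′ O′ C′
  linear-+ (counts N a b) S Z O C S′ Z′ O′ C′ = distrib (+ N) (+ a) (+ b) S Z O C S′ Z′ O′ C′
    where
    distrib : ∀ N a b S Z O C S′ Z′ O′ C′ →
      N * (S + S′) + a * (Z + Z′) + b * (O + O′) + (C + C′)
      ≡ (N * S + a * Z + b * O + C) + (N * S′ + a * Z′ + b * O′ + C′)
    distrib = solve-∀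

  linear-* : ∀ w k S Z O C → linear w (k * S) (k * Z) (k * O) (k * C) ≡ k * linear w S Z O C
  linear-* (counts N a b) k S Z O C = distrib (+ N) (+ a) (+ b) k S Z O C
    where
    distrib : ∀ N a b k S Z O C → N * (k * S) + a * (k * Z) + b * (k * O) + k * C ≡ k * (N * S + a * Z + b * O + C)
    distrib = solve-∀

  linear-τ-counts : ∀ ε w S Z O C →
    linear w (S + Z) (S + O) S (C + + ε * (S + Z)) ≡ linear (τ-counts ε w) S Z O C
  linear-τ-counts ε (counts N a b) S Z O C = begin
    + N * (S + Z) + + a * (S + O) + + b * S + (C + + ε * (S + Z))
      ≡⟨ regroup (+ N) (+ a) (+ b) (+ ε) S Z O C ⟩
    (+ N + + a + + b + + ε) * S + (+ N + + ε) * Z + + a * O + C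
      ≡⟨ cong₂ (λ p q → p * S + q * Z + + a * O + C) size-cast (pos-+ N ε) ⟨
    + (N ℕ.+ a ℕ.+ b ℕ.+ ε) * S + + (N ℕ.+ ε) * Z + + a * O + C  ∎
    where
    size-cast : + (N ℕ.+ a ℕ.+ b ℕ.+ ε) ≡ + N + + a + + b + + ε
    size-cast = trans (pos-+ _ ε) (cong (_+ + ε) (trans (pos-+ _ b) (cong (_+ + b) (pos-+ N a))))
    regroup : ∀ N a b ε S Z O C →
      N * (S + Z) + a * (S + O) + b * S + (C + ε * (S + Z)) ≡ (N + a + b + ε) * S + (N + ε) * Z + a * O + C
    regroup = solve-∀
    open ≡-Reasoning

  linear-constant : ∀ w C → linear w (+ 0) (+ 0) (+ 0) C ≡ C
  linear-constant (counts N a b) C = constant (+ N) (+ a) (+ b) C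
    where
    constant : ∀ N a b C → N * + 0 + a * + 0 + b * + 0 + C ≡ C
    constant = solve-∀

  record Form : Set where
    constructor form
    field
      onSize onZeros onOnes constant : ℤ[β]

  ⟦_⟧ᶠ : Form → Counts → ℕ → ℤ
  ⟦ form s z o c ⟧ᶠ w n = linear w (⟦ s ⟧ n) (⟦ z ⟧ n) (⟦ o ⟧ n) (⟦ c ⟧ n)

  infixl 6 _+ᶠ_
  _+ᶠ_ : Form → Form → Form
  form s z o c +ᶠ form s′ z′ o′ c′ = form (s +ᵇ s′) (z +ᵇ z′) (o +ᵇ o′) (c +ᵇ c′)

  infixr 7 _·ᶠ_
  _·ᶠ_ : ℕ → Form → Form
  k ·ᶠ form s z o c = form (k ·ᵇ s) (k ·ᵇ z) (k ·ᵇ o) (k ·ᵇ c)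

  β·ᶠ_ : Form → Form
  β·ᶠ form s z o c = form (β·ᵇ s) (β·ᵇ z) (β·ᵇ o) (β·ᵇ c)

  infixr 7 β^_·ᶠ_
  β^_·ᶠ_ : ℕ → Form → Form
  β^ zero ·ᶠ f = f
  β^ suc e ·ᶠ f = β^ e ·ᶠ β·ᶠ f

  constantPart : Form → Form
  constantPart (form s z o c) = form 0ᵇ 0ᵇ 0ᵇ c

  pullback : ℕ → Form → Form
  pullback ε (form s z o c) = form (s +ᵇ z) (s +ᵇ o) s (c +ᵇ ε ·ᵇ (s +ᵇ z))

  ⟦⟧ᶠ-+ : ∀ f g w n → ⟦ f +ᶠ g ⟧ᶠ w n ≡ ⟦ f ⟧ᶠ w n + ⟦ g ⟧ᶠ w n
  ⟦⟧ᶠ-+ (form s z o c) (form s′ z′ o′ c′) w n =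
    trans (linear-cong w (⟦⟧-+ s s′ n) (⟦⟧-+ z z′ n) (⟦⟧-+ o o′ n) (⟦⟧-+ c c′ n))
          (linear-+ w (⟦ s ⟧ n) (⟦ z ⟧ n) (⟦ o ⟧ n) (⟦ c ⟧ n) (⟦ s′ ⟧ n) (⟦ z′ ⟧ n) (⟦ o′ ⟧ n) (⟦ c′ ⟧ n))

  ⟦⟧ᶠ-· : ∀ k f w n → ⟦ k ·ᶠ f ⟧ᶠ w n ≡ + k * ⟦ f ⟧ᶠ w n
  ⟦⟧ᶠ-· k (form s z o c) w n =
    trans (linear-cong w (⟦⟧-· k s n) (⟦⟧-· k z n) (⟦⟧-· k o n) (⟦⟧-· k c n))
          (linear-* w (+ k) (⟦ s ⟧ n) (⟦ z ⟧ n) (⟦ o ⟧ n) (⟦ c ⟧ n))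

  ⟦⟧ᶠ-β^ : ∀ e f w n → ⟦ β^ e ·ᶠ f ⟧ᶠ w n ≡ ⟦ f ⟧ᶠ w (e ℕ.+ n)
  ⟦⟧ᶠ-β^ zero f w n = refl
  ⟦⟧ᶠ-β^ (suc e) f@(form s z o c) w n =
    trans (⟦⟧ᶠ-β^ e (β·ᶠ f) w n) (linear-cong w (⟦⟧-β· s m) (⟦⟧-β· z m) (⟦⟧-β· o m) (⟦⟧-β· c m))
    where m = e ℕ.+ n

  ⟦pullback⟧ᶠ : ∀ ε f w n → ⟦ pullback ε f ⟧ᶠ w n ≡ ⟦ f ⟧ᶠ (τ-counts ε w) n
  ⟦pullback⟧ᶠ ε (form s z o c) w n =
    trans (linear-cong w (⟦⟧-+ s z n) (⟦⟧-+ s o n) refl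
            (trans (⟦⟧-+ c _ n) (cong (λ t → ⟦ c ⟧ n + t) (trans (⟦⟧-· ε _ n) (cong (+ ε *_) (⟦⟧-+ s z n))))))
          (linear-τ-counts ε w (⟦ s ⟧ n) (⟦ z ⟧ n) (⟦ o ⟧ n) (⟦ c ⟧ n))

  -- A certificate that X is positive wherever the given forms are: an identity
  -- (k + 1) βˢ X = Σᵢ β^eᵢ Aᵢ, each Aᵢ one of the forms or the constant 1, to be
  -- proved by refl.
  data Atom (I : Set) : Set where
    given : I → Atom I
    one : Atom I

  units : ∀ {I} → List ℕ → List (ℕ × Atom I)
  units = map (_, one)

  module _ {I : Set} (forms : I → Form) where

    atomForm : Atom I → Form
    atomForm (given i) = forms i
    atomForm one = form 0ᵇ 0ᵇ 0ᵇ 1ᵇ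

    sumTerms : ℕ × Atom I → List (ℕ × Atom I) → Form
    sumTerms (e , a) [] = β^ e ·ᶠ atomForm a
    sumTerms (e , a) (t ∷ ts) = β^ e ·ᶠ atomForm a +ᶠ sumTerms t ts

    record Certificate (X : Form) : Set where
      constructor certificate
      field
        scale shift : ℕ
        first : ℕ × Atom I
        rest : List (ℕ × Atom I)
        identity : suc scale ·ᶠ (β^ shift ·ᶠ X) ≡ sumTerms first rest

    module _ {w : Counts} (forms-pos : ∀ i → EventuallyPositive (⟦ forms i ⟧ᶠ w)) where

      atom-pos : ∀ a → EventuallyPositive (⟦ atomForm a ⟧ᶠ w)
      atom-pos (given i) = forms-pos i
      atom-pos one = from 0 onwards λ n _ → subst (0ℤ <_)
        (sym (trans (linear-constant w (⟦ 1ᵇ ⟧ n)) (⟦1ᵇ⟧ n))) (+<+ (trib-pos n))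

      term-pos : ∀ e a → EventuallyPositive (⟦ β^ e ·ᶠ atomForm a ⟧ᶠ w)
      term-pos e a = Eventually-map (λ {n} → subst (0ℤ <_) (sym (⟦⟧ᶠ-β^ e (atomForm a) w n)))
        (Eventually-drop e (atom-pos a))

      sumTerms-pos : ∀ t ts → EventuallyPositive (⟦ sumTerms t ts ⟧ᶠ w)
      sumTerms-pos (e , a) [] = term-pos e a
      sumTerms-pos (e , a) (t ∷ ts) = Eventually-zipWith
        (λ {n} p q → subst (0ℤ <_) (sym (⟦⟧ᶠ-+ (β^ e ·ᶠ atomForm a) (sumTerms t ts) w n)) (+-mono-< p q))
        (term-pos e a) (sumTerms-pos t ts)

      certified-pos : ∀ {X} → Certificate X → EventuallyPositive (⟦ X ⟧ᶠ w)
      certified-pos {X} (certificate k s t ts eq) =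
        Eventually-undrop s (Eventually-map unscale (sumTerms-pos t ts))
        where
        unscale : ∀ {n} → 0ℤ < ⟦ sumTerms t ts ⟧ᶠ w n → 0ℤ < ⟦ X ⟧ᶠ w (s ℕ.+ n)
        unscale {n} h = *-cancelˡ-<-nonNeg (+ suc k) (begin-strict
          + suc k * 0ℤ                         ≡⟨ *-zeroʳ (+ suc k) ⟩
          0ℤ                                    <⟨ h ⟩
          ⟦ sumTerms t ts ⟧ᶠ w n                ≡⟨ cong (λ f → ⟦ f ⟧ᶠ w n) eq ⟨
          ⟦ suc k ·ᶠ (β^ s ·ᶠ X) ⟧ᶠ w n          ≡⟨ ⟦⟧ᶠ-· (suc k) (β^ s ·ᶠ X) w n ⟩
          + suc k * ⟦ β^ s ·ᶠ X ⟧ᶠ w n           ≡⟨ cong (+ suc k *_) (⟦⟧ᶠ-β^ s X w n) ⟩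
          + suc k * ⟦ X ⟧ᶠ w (s ℕ.+ n)           ∎)
          where open ≤-Reasoning


module BetaBounds where

  open Eventual
  open TribonacciForms using (trib; +trib-rec)
  open import Data.Integer using (ℤ; +_; -_; _+_; _*_; _-_; _<_; _≤_; 0ℤ; NonNegative; Positive)
  open import Data.Integer.Properties
    using (+-identityˡ; +-monoˡ-<; +-monoʳ-≤; +-mono-≤-<; *-monoˡ-<-pos; *-monoˡ-≤-nonNeg;
           *-cancelʳ-<-nonNeg; *-identityʳ; <⇒≤; module ≤-Reasoning)
  open import Data.Integer.Tactic.RingSolver using (solve-∀; solve)
  open import Data.Rational as ℚ using (_/_; toℚᵘ)
  import Data.Rational.Properties as ℚ
  open import Data.Rational.Unnormalised as ℚᵘ using (ℚᵘ; mkℚᵘ; ↥_; _≃_; *<*)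
  import Data.Rational.Unnormalised.Properties as ℚᵘ
  open ≤-Reasoning

  +-cancelʳ-< : ∀ i j k → i + k < j + k → i < j
  +-cancelʳ-< i j k lt = begin-strict
    i          ≡⟨ solve (i ∷ k ∷ []) ⟩
    i + k - k  <⟨ +-monoˡ-< (- k) lt ⟩
    j + k - k  ≡⟨ solve (j ∷ k ∷ []) ⟩
    j          ∎

  module _ {i j k : ℤ} (i+j≡k : i + j ≡ k) where

    0<i⇒j<k : 0ℤ < i → j < k
    0<i⇒j<k 0<i = begin-strict
      j       ≡⟨ +-identityˡ j ⟨
      0ℤ + j  <⟨ +-monoˡ-< j 0<i ⟩
      i + j   ≡⟨ i+j≡k ⟩
      k       ∎

    j<k⇒0<i : j < k → 0ℤ < i
    j<k⇒0<i j<k = +-cancelʳ-< 0ℤ i j (begin-strict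
      0ℤ + j  ≡⟨ +-identityˡ j ⟩
      j       <⟨ j<k ⟩
      k       ≡⟨ i+j≡k ⟨
      i + j   ∎)

    k<j⇒i<0 : k < j → i < 0ℤ
    k<j⇒i<0 k<j = +-cancelʳ-< i 0ℤ j (begin-strict
      i + j   ≡⟨ i+j≡k ⟩
      k       <⟨ k<j ⟩
      j       ≡⟨ +-identityˡ j ⟨
      0ℤ + j  ∎)

  -- With r = b/x below the ratios t₁/t₀, t₂/t₁, t₃/t₂ where t₃ = t₂ + t₁ + t₀,
  -- r < t₃/t₂ = 1 + t₁/t₂ + t₀/t₂ < 1 + 1/r + 1/r², i.e. r³ < r² + r + 1.
  module _ (b x : ℤ) .{{_ : NonNegative b}} .{{_ : Positive x}} where

    cubic-below : ∀ t₀ t₁ t₂ .{{_ : NonNegative t₂}} →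
      b * t₀ < x * t₁ → b * t₁ < x * t₂ → b * t₂ < x * (t₂ + t₁ + t₀) →
      b * b * b < b * b * x + b * x * x + x * x * x
    cubic-below t₀ t₁ t₂ h₀ h₁ h₂ = *-cancelʳ-<-nonNeg t₂ (begin-strict
      b * b * b * t₂                                            ≡⟨ solve (b ∷ t₂ ∷ []) ⟩
      b * (b * (b * t₂))                                        ≤⟨ *-monoˡ-≤-nonNeg b (*-monoˡ-≤-nonNeg b (<⇒≤ h₂)) ⟩
      b * (b * (x * (t₂ + t₁ + t₀)))                            ≡⟨ solve (b ∷ x ∷ t₀ ∷ t₁ ∷ t₂ ∷ []) ⟩
      x * b * b * t₂ + b * (x * (b * t₁)) + x * (b * (b * t₀))  <⟨ +-mono-≤-< (+-monoʳ-≤ (x * b * b * t₂) middle) last ⟩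
      x * b * b * t₂ + b * (x * (x * t₂)) + x * (x * (x * t₂))  ≡⟨ solve (b ∷ x ∷ t₂ ∷ []) ⟩
      (b * b * x + b * x * x + x * x * x) * t₂                  ∎)
      where
      middle : b * (x * (b * t₁)) ≤ b * (x * (x * t₂))
      middle = *-monoˡ-≤-nonNeg b (<⇒≤ (*-monoˡ-<-pos x h₁))
      last : x * (b * (b * t₀)) < x * (x * (x * t₂))
      last = *-monoˡ-<-pos x (begin-strict
        b * (b * t₀)  ≤⟨ *-monoˡ-≤-nonNeg b (<⇒≤ h₀) ⟩
        b * (x * t₁)  ≡⟨ solve (b ∷ x ∷ t₁ ∷ []) ⟩
        x * (b * t₁)  <⟨ *-monoˡ-<-pos x h₁ ⟩
        x * (x * t₂)  ∎)

    cubic-above : ∀ t₀ t₁ t₂ .{{_ : NonNegative t₂}} →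
      x * t₁ < b * t₀ → x * t₂ < b * t₁ → x * (t₂ + t₁ + t₀) < b * t₂ →
      b * b * x + b * x * x + x * x * x < b * b * b
    cubic-above t₀ t₁ t₂ h₀ h₁ h₂ = *-cancelʳ-<-nonNeg t₂ (begin-strict
      (b * b * x + b * x * x + x * x * x) * t₂                  ≡⟨ solve (b ∷ x ∷ t₂ ∷ []) ⟩
      x * b * b * t₂ + b * (x * (x * t₂)) + x * (x * (x * t₂))  <⟨ +-mono-≤-< (+-monoʳ-≤ (x * b * b * t₂) middle) last ⟩
      x * b * b * t₂ + b * (x * (b * t₁)) + x * (b * (b * t₀))  ≡⟨ solve (b ∷ x ∷ t₀ ∷ t₁ ∷ t₂ ∷ []) ⟩
      b * (b * (x * (t₂ + t₁ + t₀)))                            ≤⟨ *-monoˡ-≤-nonNeg b (*-monoˡ-≤-nonNeg b (<⇒≤ h₂)) ⟩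
      b * (b * (b * t₂))                                        ≡⟨ solve (b ∷ t₂ ∷ []) ⟩
      b * b * b * t₂                                            ∎)
      where
      middle : b * (x * (x * t₂)) ≤ b * (x * (b * t₁))
      middle = *-monoˡ-≤-nonNeg b (<⇒≤ (*-monoˡ-<-pos x h₁))
      last : x * (x * (x * t₂)) < x * (b * (b * t₀))
      last = *-monoˡ-<-pos x (begin-strict
        x * (x * t₂)  <⟨ *-monoˡ-<-pos x h₁ ⟩
        x * (b * t₁)  ≡⟨ solve (b ∷ x ∷ t₁ ∷ []) ⟩
        b * (x * t₁)  ≤⟨ *-monoˡ-≤-nonNeg b (<⇒≤ h₀) ⟩
        b * (b * t₀)  ∎)

  pᵘ : ℚᵘ → ℚᵘ
  pᵘ q = q ℚᵘ.* q ℚᵘ.* q ℚᵘ.- q ℚᵘ.* q ℚᵘ.- q ℚᵘ.- ℚᵘ.1ℚᵘ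

  pᵘ-cong : ∀ {q r} → q ≃ r → pᵘ q ≃ pᵘ r
  pᵘ-cong e = ℚᵘ.+-cong (ℚᵘ.+-cong (ℚᵘ.+-cong (ℚᵘ.*-cong (ℚᵘ.*-cong e e) e)
    (ℚᵘ.-‿cong (ℚᵘ.*-cong e e))) (ℚᵘ.-‿cong e)) (ℚᵘ.≃-refl {ℚᵘ.- ℚᵘ.1ℚᵘ})

  toℚᵘ-p : ∀ q → toℚᵘ (p q) ≃ pᵘ (toℚᵘ q)
  toℚᵘ-p q =
    ℚᵘ.≃-trans (ℚ.toℚᵘ-homo-+ (q ℚ.* q ℚ.* q ℚ.- q ℚ.* q ℚ.- q) (ℚ.- ℚ.1ℚ))
    (ℚᵘ.+-cong
      (ℚᵘ.≃-trans (ℚ.toℚᵘ-homo-+ (q ℚ.* q ℚ.* q ℚ.- q ℚ.* q) (ℚ.- q))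
        (ℚᵘ.+-cong
          (ℚᵘ.≃-trans (ℚ.toℚᵘ-homo-+ (q ℚ.* q ℚ.* q) (ℚ.- (q ℚ.* q)))
            (ℚᵘ.+-cong
              (ℚᵘ.≃-trans (ℚ.toℚᵘ-homo-* (q ℚ.* q) q) (ℚᵘ.*-cong (ℚ.toℚᵘ-homo-* q q) ℚᵘ.≃-refl))
              (ℚᵘ.≃-trans (ℚ.toℚᵘ-homo‿- (q ℚ.* q)) (ℚᵘ.-‿cong (ℚ.toℚᵘ-homo-* q q)))))
          (ℚ.toℚᵘ-homo‿- q)))
      (ℚ.toℚᵘ-homo‿- ℚ.1ℚ))

  toℚᵘ-p-/ : ∀ B a → toℚᵘ (p (+ B / suc a)) ≃ pᵘ (mkℚᵘ (+ B) a)
  toℚᵘ-p-/ B a = ℚᵘ.≃-trans (toℚᵘ-p (+ B / suc a)) (pᵘ-cong (ℚ.toℚᵘ-fromℚᵘ (mkℚᵘ (+ B) a)))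

  -- ↥ pᵘ (mkℚᵘ b a) computes to the left-hand side of numerator.
  ↥pᵘ : ∀ b a → let x = + suc a in
    ↥ pᵘ (mkℚᵘ b a) + x * x * x * (b * b * x + b * x * x + x * x * x) ≡ x * x * x * (b * b * b)
  ↥pᵘ b a = numerator (+ suc a)
    where
    numerator : ∀ x →
      ((b * b * b * (x * x) + - (b * b) * (x * x * x)) * x + - b * (x * x * x * (x * x))) * + 1
        + - + 1 * (x * x * x * (x * x) * x) + x * x * x * (b * b * x + b * x * x + x * x * x)
      ≡ x * x * x * (b * b * b)
    numerator x = solve (b ∷ x ∷ [])

  module _ (B a : ℕ) where

    private
      b x S : ℤ
      b = + B
      x = + suc a
      S = b * b * x + b * x * x + x * x * x

    <β-of-cubic : b * b * b < S → (+ B / suc a) <β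
    <β-of-cubic h = ℚ.toℚᵘ-cancel-< (ℚᵘ.<-respˡ-≃ (ℚᵘ.≃-sym (toℚᵘ-p-/ B a)) (*<* numerator<0))
      where
      numerator<0 : ↥ pᵘ (mkℚᵘ b a) * + 1 < 0ℤ
      numerator<0 = begin-strict
        ↥ pᵘ (mkℚᵘ b a) * + 1  ≡⟨ *-identityʳ _ ⟩
        ↥ pᵘ (mkℚᵘ b a)        <⟨ k<j⇒i<0 {j = x * x * x * S} (↥pᵘ b a) (*-monoˡ-<-pos (x * x * x) h) ⟩
        0ℤ                     ∎

    β<-of-cubic : S < b * b * b → β< (+ B / suc a)
    β<-of-cubic h = ℚ.toℚᵘ-cancel-< (ℚᵘ.<-respʳ-≃ (ℚᵘ.≃-sym (toℚᵘ-p-/ B a)) (*<* numerator>0))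
      where
      numerator>0 : 0ℤ < ↥ pᵘ (mkℚᵘ b a) * + 1
      numerator>0 = begin-strict
        0ℤ                     <⟨ j<k⇒0<i {j = x * x * x * S} (↥pᵘ b a) (*-monoˡ-<-pos (x * x * x) h) ⟩
        ↥ pᵘ (mkℚᵘ b a)        ≡⟨ *-identityʳ _ ⟨
        ↥ pᵘ (mkℚᵘ b a) * + 1  ∎

    ratio<β : Eventually (λ n → b * + trib n < x * + trib (suc n)) → (+ B / suc a) <β
    ratio<β ev with Eventually-consecutive ev
    ... | n , h₀ , h₁ , h₂ = <β-of-cubic (cubic-below b x _ _ _ h₀ h₁ h₂′)
      where
      h₂′ : b * + trib (suc (suc n)) < x * (+ trib (suc (suc n)) + + trib (suc n) + + trib n)
      h₂′ = subst (λ t → b * + trib (suc (suc n)) < x * t) (+trib-rec n) h₂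

    β<ratio : Eventually (λ n → x * + trib (suc n) < b * + trib n) → β< (+ B / suc a)
    β<ratio ev with Eventually-consecutive ev
    ... | n , h₀ , h₁ , h₂ = β<-of-cubic (cubic-above b x _ _ _ h₀ h₁ h₂′)
      where
      h₂′ : x * (+ trib (suc (suc n)) + + trib (suc n) + + trib n) < b * + trib (suc (suc n))
      h₂′ = subst (λ t → x * t < b * + trib (suc (suc n))) (+trib-rec n) h₂


module Bounds where

  open Eventual
  open TribonacciForms
  open BetaBounds using (ratio<β; β<ratio; 0<i⇒j<k)
  open import Data.Nat as ℕ using (_≤_; z≤n; s≤s)
  open import Data.Integer using (+_; -_; _+_; _*_; _<_; 0ℤ)
  open import Data.Integer.Properties using (pos-+; pos-*)
  open import Data.Integer.Tactic.RingSolver using (solve-∀)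
  open import Data.Rational using (_/_)
  open import Data.Empty using (⊥-elim)

  -- Read over ℝ, with N, a, b, c the length of w and its numbers of 0s, 1s and 2s,
  -- the six bounds say
  --   U₀, L₀ :  1 - 2.9/β < a - N/β < 1 - 0.2/β
  --   U₁, L₁ :  β - 2.9 < c - (2 - β) N < 0.8
  --   U₂, L₂ :  -0.9 < b - (2 - β)(N + a + b) < 0.8
  data Bound : Set where
    U₀ U₁ U₂ L₀ L₁ L₂ : Bound

  bound : Bound → Form
  bound U₀ = form ⟨ + 10 , + 0 , + 0 ⟩ ⟨ + 0 , - + 10 , + 0 ⟩ 0ᵇ ⟨ - + 2 , + 10 , + 0 ⟩
  bound U₁ = form ⟨ + 10 , - + 10 , + 0 ⟩ ⟨ + 10 , + 0 , + 0 ⟩ ⟨ + 10 , + 0 , + 0 ⟩ ⟨ + 8 , + 0 , + 0 ⟩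
  bound U₂ = form ⟨ + 20 , - + 10 , + 0 ⟩ ⟨ + 20 , - + 10 , + 0 ⟩ ⟨ + 10 , - + 10 , + 0 ⟩ ⟨ + 8 , + 0 , + 0 ⟩
  bound L₀ = form ⟨ - + 10 , + 0 , + 0 ⟩ ⟨ + 0 , + 10 , + 0 ⟩ 0ᵇ ⟨ + 29 , - + 10 , + 0 ⟩
  bound L₁ = form ⟨ - + 10 , + 10 , + 0 ⟩ ⟨ - + 10 , + 0 , + 0 ⟩ ⟨ - + 10 , + 0 , + 0 ⟩ ⟨ + 29 , - + 10 , + 0 ⟩
  bound L₂ = form ⟨ - + 20 , + 10 , + 0 ⟩ ⟨ - + 20 , + 10 , + 0 ⟩ ⟨ - + 10 , + 10 , + 0 ⟩ ⟨ + 9 , + 0 , + 0 ⟩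

  record Invariant (w : Counts) : Set where
    constructor invariant
    field
      bound-pos : ∀ i → EventuallyPositive (⟦ bound i ⟧ᶠ w)

  empty-certificate : ∀ i → Certificate ⊥-elim (constantPart (bound i))
  empty-certificate U₀ = certificate 0 8 (0 , one) (units (1 ∷ 7 ∷ 8 ∷ 10 ∷ 12 ∷ [])) refl
  empty-certificate U₁ = certificate 0 6 (0 , one) (units (1 ∷ 3 ∷ 5 ∷ 6 ∷ 9 ∷ [])) refl
  empty-certificate U₂ = certificate 0 6 (0 , one) (units (1 ∷ 3 ∷ 5 ∷ 6 ∷ 9 ∷ [])) refl
  empty-certificate L₀ = certificate 0 12 (0 , one) (units (1 ∷ 12 ∷ 14 ∷ 15 ∷ [])) refl
  empty-certificate L₁ = certificate 0 12 (0 , one) (units (1 ∷ 12 ∷ 14 ∷ 15 ∷ [])) refl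
  empty-certificate L₂ = certificate 0 9 (0 , one) (units (1 ∷ 5 ∷ 7 ∷ 8 ∷ 10 ∷ 12 ∷ [])) refl

  step-certificate : ∀ {ε} → ε ≤ 1 → ∀ i → Certificate bound (pullback ε (bound i))
  step-certificate z≤n U₀ = certificate 0 10 (10 , given U₁) (units (0 ∷ 2 ∷ 4 ∷ 8 ∷ 11 ∷ 13 ∷ [])) refl
  step-certificate z≤n U₁ = certificate 0 0 (0 , given U₂) [] refl
  step-certificate z≤n U₂ = certificate 1 12 (9 , given U₀)
    ((11 , given U₀) ∷ (8 , given L₂) ∷ (10 , given L₂) ∷ units (0 ∷ 1 ∷ 3 ∷ 12 ∷ [])) refl
  step-certificate z≤n L₀ = certificate 0 0 (0 , given L₁) [] refl
  step-certificate z≤n L₁ = certificate 0 12 (12 , given L₂) (units (0 ∷ 1 ∷ 5 ∷ 7 ∷ 11 ∷ 12 ∷ [])) refl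
  step-certificate z≤n L₂ = certificate 1 14 (11 , given L₀)
    ((13 , given L₀) ∷ (10 , given U₂) ∷ (12 , given U₂) ∷ units (0 ∷ 1 ∷ 6 ∷ 8 ∷ 9 ∷ 11 ∷ 14 ∷ 17 ∷ [])) refl
  step-certificate (s≤s z≤n) U₀ = certificate 0 0 (0 , given U₁) [] refl
  step-certificate (s≤s z≤n) U₁ = certificate 0 12 (12 , given U₂) (units (0 ∷ 1 ∷ 5 ∷ 7 ∷ 11 ∷ 12 ∷ [])) refl
  step-certificate (s≤s z≤n) U₂ = certificate 1 18 (15 , given U₀)
    ((17 , given U₀) ∷ (14 , given L₂) ∷ (16 , given L₂) ∷ units (0 ∷ 1 ∷ 4 ∷ 5 ∷ 7 ∷ 8 ∷ 13 ∷ 15 ∷ 18 ∷ 21 ∷ [])) refl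
  step-certificate (s≤s z≤n) L₀ = certificate 0 10 (10 , given L₁) (units (0 ∷ 2 ∷ 4 ∷ 8 ∷ 11 ∷ 13 ∷ [])) refl
  step-certificate (s≤s z≤n) L₁ = certificate 0 0 (0 , given L₂) [] refl
  step-certificate (s≤s z≤n) L₂ = certificate 1 16 (13 , given L₀)
    ((15 , given L₀) ∷ (12 , given U₂) ∷ (14 , given U₂) ∷ units (0 ∷ 2 ∷ 6 ∷ 8 ∷ 10 ∷ 16 ∷ [])) refl

  -- at the empty counts a form and its constant part agree definitionally
  Invariant-empty : Invariant empty
  Invariant-empty = invariant λ i → certified-pos ⊥-elim {empty} (λ ()) (empty-certificate i)

  Invariant-step : ∀ {ε w} → ε ≤ 1 → Invariant w → Invariant (τ-counts ε w)
  Invariant-step {ε} {w} ε≤1 (invariant inv) = invariant λ i →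
    Eventually-map (λ {n} → subst (0ℤ <_) (⟦pullback⟧ᶠ ε (bound i) w n))
      (certified-pos bound {w} inv (step-certificate ε≤1 i))

  -- positive iff 5N/(3 + 5a) < β, resp. β < 10N/(10a - 9)
  lowerForm upperForm : Form
  lowerForm = form ⟨ - + 5 , + 0 , + 0 ⟩ ⟨ + 0 , + 5 , + 0 ⟩ 0ᵇ ⟨ + 0 , + 3 , + 0 ⟩
  upperForm = form ⟨ + 10 , + 0 , + 0 ⟩ ⟨ + 0 , - + 10 , + 0 ⟩ 0ᵇ ⟨ + 0 , + 9 , + 0 ⟩

  lowerForm-certificate : Certificate bound lowerForm
  lowerForm-certificate = certificate 1 13 (13 , given L₀) (units (0 ∷ 2 ∷ 4 ∷ 6 ∷ 7 ∷ 9 ∷ 11 ∷ [])) refl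

  upperForm-certificate : Certificate bound upperForm
  upperForm-certificate = certificate 0 3 (3 , given U₀) (units (0 ∷ [])) refl

  ⟦lowerForm⟧ᶠ : ∀ N a b n →
    ⟦ lowerForm ⟧ᶠ (counts N a b) n + + (5 ℕ.* N) * + trib n ≡ + (3 ℕ.+ 5 ℕ.* a) * + trib (suc n)
  ⟦lowerForm⟧ᶠ N a b n = begin
    ⟦ lowerForm ⟧ᶠ w n + + (5 ℕ.* N) * t₀  ≡⟨ cong (λ B → ⟦ lowerForm ⟧ᶠ w n + B * t₀) (pos-* 5 N) ⟩
    ⟦ lowerForm ⟧ᶠ w n + + 5 * + N * t₀    ≡⟨ identity (+ N) (+ a) (+ b) t₀ t₁ (+ trib (suc (suc n))) ⟩
    (+ 3 + + 5 * + a) * t₁                 ≡⟨ cong (_* t₁) cast ⟨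
    + (3 ℕ.+ 5 ℕ.* a) * t₁                 ∎
    where
    identity : ∀ N a b t₀ t₁ t₂ →
      N * (- + 5 * t₀ + + 0 * t₁ + + 0 * t₂) + a * (+ 0 * t₀ + + 5 * t₁ + + 0 * t₂)
        + b * (+ 0 * t₀ + + 0 * t₁ + + 0 * t₂) + (+ 0 * t₀ + + 3 * t₁ + + 0 * t₂) + + 5 * N * t₀
      ≡ (+ 3 + + 5 * a) * t₁
    identity = solve-∀
    w = counts N a b
    t₀ = + trib n
    t₁ = + trib (suc n)
    cast : + (3 ℕ.+ 5 ℕ.* a) ≡ + 3 + + 5 * + a
    cast = trans (pos-+ 3 (5 ℕ.* a)) (cong (λ c → + 3 + c) (pos-* 5 a))
    open ≡-Reasoning

  ⟦upperForm⟧ᶠ : ∀ N k b n →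
    ⟦ upperForm ⟧ᶠ (counts N (suc k) b) n + + (1 ℕ.+ 10 ℕ.* k) * + trib (suc n) ≡ + (10 ℕ.* N) * + trib n
  ⟦upperForm⟧ᶠ N k b n = begin
    ⟦ upperForm ⟧ᶠ w n + + (1 ℕ.+ 10 ℕ.* k) * t₁  ≡⟨ cong (λ A → ⟦ upperForm ⟧ᶠ w n + A * t₁) cast ⟩
    ⟦ upperForm ⟧ᶠ w n + (+ 1 + + 10 * + k) * t₁   ≡⟨ identity (+ N) (+ k) (+ b) t₀ t₁ (+ trib (suc (suc n))) ⟩
    + 10 * + N * t₀                                ≡⟨ cong (_* t₀) (pos-* 10 N) ⟨
    + (10 ℕ.* N) * t₀                              ∎
    where
    identity : ∀ N k b t₀ t₁ t₂ →
      N * (+ 10 * t₀ + + 0 * t₁ + + 0 * t₂) + (+ 1 + k) * (+ 0 * t₀ + - + 10 * t₁ + + 0 * t₂)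
        + b * (+ 0 * t₀ + + 0 * t₁ + + 0 * t₂) + (+ 0 * t₀ + + 9 * t₁ + + 0 * t₂) + (+ 1 + + 10 * k) * t₁
      ≡ + 10 * N * t₀
    identity = solve-∀
    w = counts N (suc k) b
    t₀ = + trib n
    t₁ = + trib (suc n)
    cast : + (1 ℕ.+ 10 ℕ.* k) ≡ + 1 + + 10 * + k
    cast = trans (pos-+ 1 (10 ℕ.* k)) (cong (λ c → + 1 + c) (pos-* 10 k))
    open ≡-Reasoning

  lower-bound : ∀ w → Invariant w → (+ (5 ℕ.* Counts.size w) / (3 ℕ.+ 5 ℕ.* Counts.zeros w)) <β
  lower-bound (counts N a b) (invariant inv) = ratio<β (5 ℕ.* N) (2 ℕ.+ 5 ℕ.* a)
    (Eventually-map (λ {n} → 0<i⇒j<k (⟦lowerForm⟧ᶠ N a b n))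
      (certified-pos bound {counts N a b} inv lowerForm-certificate))

  upper-bound : ∀ w k → Invariant w → Counts.zeros w ≡ suc k → β< (+ (10 ℕ.* Counts.size w) / (1 ℕ.+ 10 ℕ.* k))
  upper-bound (counts N .(suc k) b) k (invariant inv) refl = β<ratio (10 ℕ.* N) (10 ℕ.* k)
    (Eventually-map (λ {n} → 0<i⇒j<k (⟦upperForm⟧ᶠ N k b n))
      (certified-pos bound {counts N (suc k) b} inv upperForm-certificate))


module Prefixes where

  open TribonacciForms using (Counts; counts; empty; τ-counts)
  open Bounds using (Invariant; Invariant-empty; Invariant-step)
  open import Data.Nat using (_+_; _<_; _≤_; z≤n; s≤s)
  open import Data.Nat.Properties using (≤-trans; <⇒≤; m≤n⇒m≤1+n; m≤n⇒m⊓n≡m)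
  open import Data.Nat.Tactic.RingSolver using (solve-∀)
  open import Data.Fin using (zero; suc)
  open import Data.List using (_++_; foldr; take; length; replicate)
  open import Data.List.Properties using (++-assoc; foldr-++; length-take)
  open ≡-Reasoning

  prefix-of-τ : ∀ u N → ∃[ M ] ∃[ ε ] ε ≤ 1 × take N (τ u) ≡ τ (take M u) ++ replicate ε zero
  prefix-of-τ u zero = 0 , 0 , z≤n , refl
  prefix-of-τ [] (suc N) = 0 , 0 , z≤n , refl
  prefix-of-τ (zero ∷ u) (suc zero) = 0 , 1 , s≤s z≤n , refl
  prefix-of-τ (suc zero ∷ u) (suc zero) = 0 , 1 , s≤s z≤n , refl
  prefix-of-τ (zero ∷ u) (suc (suc N)) with prefix-of-τ u N
  ... | M , ε , ε≤1 , eq = suc M , ε , ε≤1 , cong (τ-letter zero ++_) eq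
  prefix-of-τ (suc zero ∷ u) (suc (suc N)) with prefix-of-τ u N
  ... | M , ε , ε≤1 , eq = suc M , ε , ε≤1 , cong (τ-letter (suc zero) ++_) eq
  prefix-of-τ (suc (suc zero) ∷ u) (suc N) with prefix-of-τ u N
  ... | M , ε , ε≤1 , eq = suc M , ε , ε≤1 , cong (τ-letter (suc (suc zero)) ++_) eq

  addLetter : Letter → Counts → Counts
  addLetter zero (counts N a b) = counts (suc N) (suc a) b
  addLetter (suc zero) (counts N a b) = counts (suc N) a (suc b)
  addLetter (suc (suc zero)) (counts N a b) = counts (suc N) a b

  addWord : List Letter → Counts → Counts
  addWord w c = foldr addLetter c w

  countsOf : List Letter → Counts
  countsOf w = addWord w empty

  countsOf-size : ∀ w → Counts.size (countsOf w) ≡ length w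
  countsOf-size [] = refl
  countsOf-size (zero ∷ w) = cong suc (countsOf-size w)
  countsOf-size (suc zero ∷ w) = cong suc (countsOf-size w)
  countsOf-size (suc (suc zero) ∷ w) = cong suc (countsOf-size w)

  countsOf-zeros : ∀ w → Counts.zeros (countsOf w) ≡ count0 w
  countsOf-zeros [] = refl
  countsOf-zeros (zero ∷ w) = cong suc (countsOf-zeros w)
  countsOf-zeros (suc zero ∷ w) = countsOf-zeros w
  countsOf-zeros (suc (suc zero) ∷ w) = countsOf-zeros w

  countsOf-zeros-only : ∀ ε → countsOf (replicate ε zero) ≡ counts ε ε 0
  countsOf-zeros-only zero = refl
  countsOf-zeros-only (suc ε) = cong (addLetter zero) (countsOf-zeros-only ε)

  addWord-τ-letter : ∀ ε ℓ w → addWord (τ-letter ℓ) (τ-counts ε w) ≡ τ-counts ε (addLetter ℓ w)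
  addWord-τ-letter ε zero (counts N a b) = cong (λ s → counts s (suc (N + ε)) (suc a)) (size N a b ε)
    where
    size : ∀ N a b ε → suc (suc (N + a + b + ε)) ≡ suc N + suc a + b + ε
    size = solve-∀
  addWord-τ-letter ε (suc zero) (counts N a b) = cong (λ s → counts s (suc (N + ε)) a) (size N a b ε)
    where
    size : ∀ N a b ε → suc (suc (N + a + b + ε)) ≡ suc N + a + suc b + ε
    size = solve-∀
  addWord-τ-letter ε (suc (suc zero)) (counts N a b) = refl

  countsOf-τ : ∀ ε u → countsOf (τ u ++ replicate ε zero) ≡ τ-counts ε (countsOf u)
  countsOf-τ ε [] = countsOf-zeros-only ε
  countsOf-τ ε (ℓ ∷ u) = begin
    countsOf ((τ-letter ℓ ++ τ u) ++ replicate ε zero)    ≡⟨ cong countsOf (++-assoc (τ-letter ℓ) (τ u) _) ⟩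
    countsOf (τ-letter ℓ ++ (τ u ++ replicate ε zero))    ≡⟨ foldr-++ addLetter empty (τ-letter ℓ) _ ⟩
    addWord (τ-letter ℓ) (countsOf (τ u ++ replicate ε zero)) ≡⟨ cong (addWord (τ-letter ℓ)) (countsOf-τ ε u) ⟩
    addWord (τ-letter ℓ) (τ-counts ε (countsOf u))        ≡⟨ addWord-τ-letter ε ℓ (countsOf u) ⟩
    τ-counts ε (countsOf (ℓ ∷ u))                         ∎

  Invariant-take-τⁿ0 : ∀ K N → Invariant (countsOf (take N (τⁿ0 K)))
  Invariant-take-τⁿ0 zero zero = Invariant-empty
  Invariant-take-τⁿ0 zero (suc zero) = Invariant-step {w = empty} (s≤s z≤n) Invariant-empty
  Invariant-take-τⁿ0 zero (suc (suc _)) = Invariant-step {w = empty} (s≤s z≤n) Invariant-empty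
  Invariant-take-τⁿ0 (suc K) N with prefix-of-τ (τⁿ0 K) N
  ... | M , ε , ε≤1 , eq = subst Invariant (sym (trans (cong countsOf eq) (countsOf-τ ε (take M (τⁿ0 K)))))
    (Invariant-step ε≤1 (Invariant-take-τⁿ0 K M))

  τⁿ0-head : ∀ n → ∃[ r ] τⁿ0 n ≡ zero ∷ r
  τⁿ0-head zero = [] , refl
  τⁿ0-head (suc n) with τⁿ0 n | τⁿ0-head n
  ... | .(zero ∷ r) | r , refl = suc zero ∷ τ r , refl

  length-τ : ∀ u → length u ≤ length (τ u)
  length-τ [] = z≤n
  length-τ (zero ∷ u) = m≤n⇒m≤1+n (s≤s (length-τ u))
  length-τ (suc zero ∷ u) = m≤n⇒m≤1+n (s≤s (length-τ u))
  length-τ (suc (suc zero) ∷ u) = s≤s (length-τ u)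

  length-τⁿ0 : ∀ n → n < length (τⁿ0 n)
  length-τⁿ0 zero = s≤s z≤n
  length-τⁿ0 (suc n) with τⁿ0 n | τⁿ0-head n | length-τⁿ0 n
  ... | .(zero ∷ r) | r , refl | n<1+|r| = s≤s (≤-trans n<1+|r| (s≤s (length-τ r)))

  length-prefix : ∀ N → length (prefix N) ≡ N
  length-prefix N = trans (length-take N (τⁿ0 N)) (m≤n⇒m⊓n≡m (<⇒≤ (length-τⁿ0 N)))

  prefixCounts : ℕ → Counts
  prefixCounts N = counts N (count0 (prefix N)) (Counts.ones (countsOf (prefix N)))

  countsOf-prefix : ∀ N → countsOf (prefix N) ≡ prefixCounts N
  countsOf-prefix N = cong₂ (λ s z → counts s z (Counts.ones (countsOf (prefix N))))
    (trans (countsOf-size (prefix N)) (length-prefix N)) (countsOf-zeros (prefix N))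

  Invariant-prefix : ∀ N → Invariant (prefixCounts N)
  Invariant-prefix N = subst Invariant (countsOf-prefix N) (Invariant-take-τⁿ0 N N)


open Bounds using (lower-bound; upper-bound)
open Prefixes using (prefixCounts; Invariant-prefix)
open import Data.Nat using (_+_; _*_)
open import Data.Integer using (+_)
open import Data.Rational using (_/_)

proposition1 : (N : ℕ) →
    ((+ (5 * N) / (3 + 5 * count0 (prefix N))) <β)
    × ((k : ℕ) → count0 (prefix N) ≡ suc k → β< (+ (10 * N) / (1 + 10 * k)))
proposition1 N = lower-bound w (Invariant-prefix N) , λ k → upper-bound w k (Invariant-prefix N)
  where w = prefixCounts N
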